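{- Let $X$ be a finite nonempty set and let $\mathcal F\subseteq 2^{X}$ be a family of subsets of $X$ with $|\mathcal F|>2^{|X|-1}$. Then there is a subfamily $\mathcal G\subseteq\mathcal F$ with $|\mathcal G|\le\lceil\log_2|X|\rceil+1$ that separates $X$.
   Context: A subset $F\subseteq X$ separates two elements $x,y\in X$ if it contains exactly one of them. A family $\mathcal G$ of subsets of $X$ separates $X$ if every pair of distinct elements of $X$ is separated by at least one member of $\mathcal G$. -}

module Defs where

open import Data.Nat using (ℕ)
open import Data.Fin using (Fin)
open import Data.Fin.Subset using (Subset; _∈_; _∉_)
open import Data.List using (List)
open import Data.List.Relation.Unary.Any using (Any)
open import Data.Product using (_×_)
open import Data.Sum using (_⊎_)
open import Relation.Binary.PropositionalEquality using (_≡_)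
open import Relation.Nullary using (¬_)

SeparatesPair : ∀ {n} → Subset n → Fin n → Fin n → Set
SeparatesPair F x y = (x ∈ F × y ∉ F) ⊎ (y ∈ F × x ∉ F)

Separates : ∀ {n} → List (Subset n) → Set
Separates {n} 𝒢 = (x y : Fin n) → ¬ (x ≡ y) → Any (λ F → SeparatesPair F x y) 𝒢

module Submission where

open import Defs
open import Data.Nat using (ℕ; suc; _+_; _∸_; _^_; _<_; _≤_)
open import Data.Nat.Logarithm using (⌈log₂_⌉)
open import Data.Fin.Subset using (Subset)
open import Data.List using (List; length)
open import Data.List.Relation.Unary.All using (All)
open import Data.List.Relation.Unary.Unique.Propositional using (Unique)
open import Data.List.Membership.Propositional using (_∈_)
open import Data.Product using (Σ; _×_)

open import Algebra.Bundles using (CommutativeRing)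
open import Data.Bool using (Bool; true; false; not; _∧_; _xor_)
open import Data.Bool.Properties using (xor-∧-commutativeRing; xor-assoc; xor-comm; xor-same; xor-identityʳ; ∧-distribʳ-xor)
  renaming (_≟_ to _≟ᵇ_)
open import Data.Empty using (⊥-elim)
open import Data.Fin using (Fin; zero; suc; splitAt; _↑ˡ_; _↑ʳ_; inject≤)
open import Data.Fin.Properties using (splitAt⁻¹-↑ˡ; splitAt⁻¹-↑ʳ; inject≤-injective)
open import Data.List using ([]; _∷_; map; _++_; filter)
import Data.List as List
open import Data.List.Properties using (length-map; length-++)
open import Data.List.Relation.Unary.Any using (Any; here; there)
import Data.List.Relation.Unary.Any as Any
import Data.List.Relation.Unary.Any.Properties as Any
import Data.List.Relation.Unary.All as All
import Data.List.Relation.Unary.All.Properties as All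
open import Data.List.Relation.Unary.All using ([]; _∷_)
open import Data.List.Relation.Unary.AllPairs using ([]; _∷_)
open import Data.List.Relation.Unary.Unique.Propositional.Properties using (++⁺; filter⁺)
  renaming (map⁺ to unique-map⁺)
open import Data.List.Membership.Propositional using (find; lose)
open import Data.List.Membership.Propositional.Properties using (∈-map⁻; ∈-++⁻; ∈-filter⁻; ∈-lookup)
open import Data.Nat using (zero; _*_; z≤n; s≤s; ⌈_/2⌉; ⌊_/2⌋; _≤?_)
open import Data.Nat.Induction using (<-rec)
open import Data.Nat.Logarithm using (⌈log₂⌉-mono-≤; ⌈log₂2^n⌉≡n; ⌈log₂⌈n/2⌉⌉≡⌈log₂n⌉∸1)
open import Data.Nat.Properties
open import Data.Product using (_,_; proj₁; proj₂)
open import Data.Sum using (_⊎_; inj₁; inj₂)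
import Data.Sum as Sum
open import Data.Vec using (Vec; []; _∷_; head; tail; lookup; tabulate; replicate; zipWith)
open import Data.Vec.Properties using (∷-injectiveʳ; lookup∘tabulate; tabulate∘lookup; tabulate-cong; lookup⇒[]=; []=⇒lookup; ≡-dec)
open import Function using (_∘_; id)
open import Relation.Binary.PropositionalEquality
open import Relation.Nullary using (¬_; yes; no; contradiction)
open import Relation.Nullary.Decidable using (_×-dec_)
open import Algebra.Properties.CommutativeSemigroup
  (CommutativeRing.+-commutativeSemigroup xor-∧-commutativeRing) using () renaming (interchange to xor-interchange)

-- Put L = ⌈log₂ n⌉ and m = n - L, so that L ≤ n ≤ 2^L.  Code the
-- first L points of X = Fin (L + m) by the unit vectors of F₂^L and the other m
-- points by distinct non-unit vectors (there are 2^L - L of them).  A subset v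
-- is determined by its restriction low v ∈ F₂^L to the first L points and a
-- residual r ∈ F₂^m, and its indicator is v(x) = ⟨code x, low v⟩ ⊕ offset r x.
-- By pigeonhole a residual class P ⊆ F holds a 2^-m share of F, so low(P) fills
-- more than half of F₂^L and therefore contains L + 1 points lying in no proper
-- affine subspace (induction splitting the cube along a coordinate).  For x ≠ y
-- the affine function u ↦ (offset r x ⊕ offset r y) ⊕ ⟨code x ⊕ code y, u⟩ is
-- nonzero at one of those points, whose member of F then separates x and y.

unique-map-on : ∀ {A B : Set} (f : A → B) {xs : List A} → Unique xs →
  (∀ {x y} → x ∈ xs → y ∈ xs → f x ≡ f y → x ≡ y) → Unique (map f xs)
unique-map-on f [] _ = []
unique-map-on f (x∉xs ∷ xs-unique) injective =
  All.map⁺ (All.tabulate λ y∈xs fx≡fy → All.lookup x∉xs y∈xs (injective (here refl) (there y∈xs) fx≡fy))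
  ∷ unique-map-on f xs-unique (λ x∈ y∈ → injective (there x∈) (there y∈))

lift-along : ∀ {A B : Set} (f : A → B) {P : List A} {G : List B} → All (_∈ map f P) G →
  Σ (List A) λ G′ → All (_∈ P) G′ × map f G′ ≡ G
lift-along f [] = [] , [] , refl
lift-along f (g∈ ∷ gs) with ∈-map⁻ f g∈ | lift-along f gs
... | a , a∈P , refl | G′ , G′⊆P , refl = a ∷ G′ , a∈P ∷ G′⊆P , refl

member-of-nonempty : ∀ {A : Set} {xs : List A} → 0 < length xs → Σ A (_∈ xs)
member-of-nonempty {xs = x ∷ _} _ = x , here refl

sum≤twice-larger : ∀ {a b n} → a + b ≡ n → b ≤ a → n ≤ 2 * a
sum≤twice-larger {a} {b} refl b≤a = begin
  a + b       ≤⟨ +-monoʳ-≤ a b≤a ⟩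
  a + a       ≡⟨ cong (a +_) (sym (+-identityʳ a)) ⟩
  2 * a       ∎
  where open ≤-Reasoning

2^j+2^j : ∀ j → 2 ^ j + 2 ^ j ≡ 2 ^ suc j
2^j+2^j j = cong (2 ^ j +_) (sym (+-identityʳ (2 ^ j)))

module Split {A : Set} (f : A → Bool) where

  part : Bool → List A → List A
  part b = filter (λ x → f x ≟ᵇ b)

  part-∈ : ∀ {b x xs} → x ∈ part b xs → x ∈ xs × f x ≡ b
  part-∈ {b} {xs = xs} = ∈-filter⁻ (λ x → f x ≟ᵇ b) {xs = xs}

  part-unique : ∀ {b xs} → Unique xs → Unique (part b xs)
  part-unique {b} = filter⁺ (λ x → f x ≟ᵇ b)

  part-length : ∀ b xs → length (part b xs) + length (part (not b) xs) ≡ length xs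
  part-length true xs = true+false xs
    where
    true+false : ∀ xs → length (part true xs) + length (part false xs) ≡ length xs
    true+false [] = refl
    true+false (x ∷ xs) with f x
    ... | true  = cong suc (true+false xs)
    ... | false = trans (+-suc _ _) (cong suc (true+false xs))
  part-length false xs = trans (+-comm (length (part false xs)) _) (part-length true xs)

  majority : ∀ xs → Σ Bool λ b → length xs ≤ 2 * length (part b xs)
  majority xs with length (part false xs) ≤? length (part true xs)
  ... | yes f≤t = true  , sum≤twice-larger (part-length true xs) f≤t
  ... | no  f≰t = false , sum≤twice-larger (part-length false xs) (<⇒≤ (≰⇒> f≰t))

head-tail-injective : ∀ {A : Set} {j} {x y : Vec A (suc j)} → head x ≡ head y → tail x ≡ tail y → x ≡ y
head-tail-injective {x = _ ∷ _} {_ ∷ _} refl refl = refl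

module _ {j : ℕ} where

  zeros : Vec Bool j
  zeros = replicate j false

  _⊕_ : Vec Bool j → Vec Bool j → Vec Bool j
  _⊕_ = zipWith _xor_

dot : ∀ {j} → Vec Bool j → Vec Bool j → Bool
dot [] [] = false
dot (a ∷ d) (b ∷ x) = (a ∧ b) xor dot d x

dot-zerosˡ : ∀ {j} (x : Vec Bool j) → dot zeros x ≡ false
dot-zerosˡ [] = refl
dot-zerosˡ (_ ∷ x) = dot-zerosˡ x

dot-⊕ˡ : ∀ {j} (d d′ x : Vec Bool j) → dot (d ⊕ d′) x ≡ dot d x xor dot d′ x
dot-⊕ˡ [] [] [] = refl
dot-⊕ˡ (a ∷ d) (a′ ∷ d′) (b ∷ x) = begin
  ((a xor a′) ∧ b) xor dot (d ⊕ d′) x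
    ≡⟨ cong₂ _xor_ (∧-distribʳ-xor b a a′) (dot-⊕ˡ d d′ x) ⟩
  ((a ∧ b) xor (a′ ∧ b)) xor (dot d x xor dot d′ x)
    ≡⟨ xor-interchange (a ∧ b) (a′ ∧ b) (dot d x) (dot d′ x) ⟩
  ((a ∧ b) xor dot d x) xor ((a′ ∧ b) xor dot d′ x) ∎
  where open ≡-Reasoning

⊕-zero⇒≡ : ∀ {j} {d d′ : Vec Bool j} → d ⊕ d′ ≡ zeros → d ≡ d′
⊕-zero⇒≡ {d = []} {[]} _ = refl
⊕-zero⇒≡ {d = false ∷ d} {false ∷ d′} eq = cong (false ∷_) (⊕-zero⇒≡ (∷-injectiveʳ eq))
⊕-zero⇒≡ {d = true  ∷ d} {true  ∷ d′} eq = cong (true ∷_) (⊕-zero⇒≡ (∷-injectiveʳ eq))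
⊕-zero⇒≡ {d = false ∷ d} {true  ∷ d′} ()
⊕-zero⇒≡ {d = true  ∷ d} {false ∷ d′} ()

unit : ∀ {j} → Fin j → Vec Bool j
unit zero    = true ∷ zeros
unit (suc i) = false ∷ unit i

unit-injective : ∀ {j} {i i′ : Fin j} → unit i ≡ unit i′ → i ≡ i′
unit-injective {i = zero}  {zero}   _  = refl
unit-injective {i = suc i} {suc i′} eq = cong suc (unit-injective (∷-injectiveʳ eq))
unit-injective {i = zero}  {suc _}  ()
unit-injective {i = suc _} {zero}   ()

dot-unit : ∀ {j} (i : Fin j) (x : Vec Bool j) → dot (unit i) x ≡ lookup x i
dot-unit zero    (b ∷ x) = trans (cong (b xor_) (dot-zerosˡ x)) (xor-identityʳ b)
dot-unit (suc i) (b ∷ x) = dot-unit i x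

-- The pair (κ, d) encodes the affine function u ↦ κ ⊕ ⟨d, u⟩ on F₂^j;
-- it is the zero function exactly when κ = false and d = 0.
IsZeroAffine : ∀ {j} → Bool → Vec Bool j → Set
IsZeroAffine κ d = κ ≡ false × d ≡ zeros

Meets : ∀ {j} → List (Vec Bool j) → Bool → Vec Bool j → Set
Meets G κ d = Any (λ g → κ xor dot d g ≡ true) G

-- G lies in no proper affine subspace: every nonzero affine function is
-- nonzero somewhere on G.
AffinelySpanning : ∀ {j} → List (Vec Bool j) → Set
AffinelySpanning G = ∀ κ d → ¬ IsZeroAffine κ d → Meets G κ d

module _ {j : ℕ} where
  open Split {Vec Bool (suc j)} head

  slice : Bool → List (Vec Bool (suc j)) → List (Vec Bool j)
  slice s C = map tail (part s C)

  slice-∈ : ∀ {s C v} → v ∈ slice s C → (s ∷ v) ∈ C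
  slice-∈ {s} {C} v∈ with ∈-map⁻ tail v∈
  ... | u , u∈ , refl with part-∈ {xs = C} u∈
  ... | u∈C , head≡s = subst (_∈ C) (head-tail-injective head≡s refl) u∈C

  -- slicing keeps duplicate-freeness, as the dropped coordinate is the same s
  slice-unique : ∀ {s C} → Unique C → Unique (slice s C)
  slice-unique {s} {C} C-unique = unique-map-on tail (part-unique C-unique)
    λ x∈ y∈ → head-tail-injective (trans (proj₂ (part-∈ {xs = C} x∈)) (sym (proj₂ (part-∈ {xs = C} y∈))))

  slice-length : ∀ s C → length (slice s C) + length (slice (not s) C) ≡ length C
  slice-length s C = trans (cong₂ _+_ (length-map tail (part s C)) (length-map tail (part (not s) C)))
                           (part-length s C)

  slice-majority : ∀ C → Σ Bool λ s → length C ≤ 2 * length (slice s C)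
  slice-majority C with majority C
  ... | s , maj = s , subst (λ k → length C ≤ 2 * k) (sym (length-map tail (part s C))) maj

cube-bound : ∀ j (C : List (Vec Bool j)) → Unique C → length C ≤ 2 ^ j
cube-bound zero [] _ = z≤n
cube-bound zero ([] ∷ []) _ = s≤s z≤n
cube-bound zero ([] ∷ [] ∷ _) ((x≢y ∷ _) ∷ _) = ⊥-elim (x≢y refl)
cube-bound (suc j) C C-unique = begin
  length C                                          ≡⟨ sym (slice-length true C) ⟩
  length (slice true C) + length (slice false C)    ≤⟨ +-mono-≤ (cube-bound j _ (slice-unique C-unique))
                                                                (cube-bound j _ (slice-unique C-unique)) ⟩
  2 ^ j + 2 ^ j                                     ≡⟨ 2^j+2^j j ⟩
  2 ^ suc j                                         ∎
  where open ≤-Reasoning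

record LargeFiber {A : Set} {m : ℕ} (r : A → Vec Bool m) (F : List A) : Set where
  field
    value    : Vec Bool m
    members  : List A
    unique   : Unique members
    ⊆F       : ∀ {v} → v ∈ members → v ∈ F
    on-fiber : ∀ {v} → v ∈ members → r v ≡ value
    large    : length F ≤ 2 ^ m * length members

large-fiber : ∀ m {A : Set} (r : A → Vec Bool m) (F : List A) → Unique F → LargeFiber r F
large-fiber zero r F F-unique = record
  { value = [] ; members = F ; unique = F-unique ; ⊆F = id
  ; on-fiber = λ {v} _ → empty (r v) ; large = ≤-reflexive (sym (*-identityˡ _)) }
  where
  empty : (u : Vec Bool 0) → u ≡ []
  empty [] = refl
large-fiber (suc m) r F F-unique = record
  { value = b ∷ value ; members = members ; unique = unique
  ; ⊆F = λ v∈ → proj₁ (part-∈ {xs = F} (⊆F v∈))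
  ; on-fiber = λ v∈ → head-tail-injective (proj₂ (part-∈ {xs = F} (⊆F v∈))) (on-fiber v∈)
  ; large = begin
      length F                        ≤⟨ proj₂ (majority F) ⟩
      2 * length (part b F)           ≤⟨ *-monoʳ-≤ 2 large ⟩
      2 * (2 ^ m * length members)    ≡⟨ sym (*-assoc 2 (2 ^ m) _) ⟩
      2 ^ suc m * length members      ∎ }
  where
  open ≤-Reasoning
  open Split (head ∘ r)
  b : Bool
  b = proj₁ (majority F)
  open LargeFiber (large-fiber m (tail ∘ r) (part b F) (part-unique F-unique))

-- Induction on j: a denser half {s} × C_s yields such
-- points for F₂^j, and one point w of the other half is added; the only nonzero
-- affine functions vanishing on the s-half are u ↦ u₀ ⊕ s, which w meets.
general-position : ∀ j (C : List (Vec Bool j)) → Unique C → 2 ^ j < 2 * length C →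
  Σ (List (Vec Bool j)) λ G → All (_∈ C) G × length G ≤ suc j × AffinelySpanning G
general-position zero ([] ∷ _) _ _ = [] ∷ [] , here refl ∷ [] , s≤s z≤n , spans
  where
  spans : AffinelySpanning ([] ∷ [])
  spans true  [] _       = here refl
  spans false [] nonzero = ⊥-elim (nonzero (refl , refl))
general-position (suc j) C C-unique dense
  with slice-majority C
... | s , C≤2Cs
  with general-position j (slice s C) (slice-unique C-unique) (<-≤-trans 2^j<C C≤2Cs)
     | member-of-nonempty (other-half-nonempty (slice-length s C) (cube-bound j _ (slice-unique C-unique)) 2^j<C)
  where
  -- C is larger than a half cube, so the half opposite to s is nonempty
  2^j<C : 2 ^ j < length C
  2^j<C = *-cancelˡ-< 2 (2 ^ j) (length C) dense
  other-half-nonempty : ∀ {a b k n} → a + b ≡ n → a ≤ k → k < n → 0 < b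
  other-half-nonempty {a} {zero} refl a≤k k<n = contradiction (≤-trans (≤-reflexive (+-identityʳ a)) a≤k) (<⇒≱ k<n)
  other-half-nonempty {b = suc _} _ _ _ = s≤s z≤n
... | Gs , Gs⊆Cs , |Gs|≤j+1 , Gs-spans | w , w∈ =
  (not s ∷ w) ∷ map (s ∷_) Gs , slice-∈ w∈ ∷ All.map⁺ (All.map slice-∈ Gs⊆Cs) ,
  s≤s (≤-trans (≤-reflexive (length-map (s ∷_) Gs)) |Gs|≤j+1) , spans
  where
  -- Restricted to the s-half, (κ, d₀ ∷ d) becomes (κ ⊕ d₀ ∧ s, d): if that is
  -- nonzero a point of Gs meets it, otherwise (κ, d₀ ∷ d) = (s, e₀) and w meets it.
  spans : AffinelySpanning ((not s ∷ w) ∷ map (s ∷_) Gs)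
  spans κ (d₀ ∷ d) nonzero with ((κ xor (d₀ ∧ s)) ≟ᵇ false) ×-dec (≡-dec _≟ᵇ_ d zeros)
  ... | no restriction-nonzero =
    there (Any.map⁺ (Any.map (λ hit → trans (sym (xor-assoc κ (d₀ ∧ s) _)) hit)
                             (Gs-spans _ d restriction-nonzero)))
  ... | yes (restriction-zero , refl) = here (meets-w κ d₀ restriction-zero nonzero)
    where
    other-value : ∀ κ s → κ xor s ≡ false → κ xor (not s xor false) ≡ true
    other-value false false _ = refl
    other-value true  true  _ = refl
    meets-w : ∀ κ d₀ → κ xor (d₀ ∧ s) ≡ false → ¬ IsZeroAffine κ (d₀ ∷ zeros) →
              κ xor ((d₀ ∧ not s) xor dot zeros w) ≡ true
    meets-w κ false eq nonzero = ⊥-elim (nonzero (trans (sym (xor-identityʳ κ)) eq , refl))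
    meets-w κ true  eq _ rewrite dot-zerosˡ w = other-value κ s eq

glue : ∀ {j} → List (Vec Bool j) → List (Vec Bool j) → List (Vec Bool (suc j))
glue xs ys = map (true ∷_) xs ++ map (false ∷_) ys

glue-length : ∀ {j} (xs ys : List (Vec Bool j)) → length (glue xs ys) ≡ length xs + length ys
glue-length xs ys = trans (length-++ (map (true ∷_) xs)) (cong₂ _+_ (length-map _ xs) (length-map _ ys))

glue-∈ : ∀ {j} {v : Vec Bool (suc j)} xs ys → v ∈ glue xs ys →
  Σ (Vec Bool j) (λ u → u ∈ xs × v ≡ true ∷ u) ⊎ Σ (Vec Bool j) (λ u → u ∈ ys × v ≡ false ∷ u)
glue-∈ xs ys v∈ = Sum.map (∈-map⁻ (true ∷_)) (∈-map⁻ (false ∷_)) (∈-++⁻ (map (true ∷_) xs) v∈)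

glue-unique : ∀ {j} {xs ys : List (Vec Bool j)} → Unique xs → Unique ys → Unique (glue xs ys)
glue-unique {xs = xs} {ys} xs-unique ys-unique =
  ++⁺ (unique-map⁺ ∷-injectiveʳ xs-unique) (unique-map⁺ ∷-injectiveʳ ys-unique) disjoint
  where
  disjoint : ∀ {v} → ¬ (v ∈ map (true ∷_) xs × v ∈ map (false ∷_) ys)
  disjoint (v∈₁ , v∈₂) with ∈-map⁻ (true ∷_) v∈₁ | ∈-map⁻ (false ∷_) v∈₂
  ... | _ , _ , refl | _ , _ , ()

cube nonzero nonunit : ∀ j → List (Vec Bool j)
cube zero          = [] ∷ []
cube (suc j)       = glue (cube j) (cube j)
nonzero zero       = []
nonzero (suc j)    = glue (cube j) (nonzero j)
nonunit zero       = [] ∷ []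
nonunit (suc j)    = glue (nonzero j) (nonunit j)

cube-unique : ∀ j → Unique (cube j)
cube-unique zero    = [] ∷ []
cube-unique (suc j) = glue-unique (cube-unique j) (cube-unique j)

nonzero-unique : ∀ j → Unique (nonzero j)
nonzero-unique zero    = []
nonzero-unique (suc j) = glue-unique (cube-unique j) (nonzero-unique j)

nonunit-unique : ∀ j → Unique (nonunit j)
nonunit-unique zero    = [] ∷ []
nonunit-unique (suc j) = glue-unique (nonzero-unique j) (nonunit-unique j)

cube-length : ∀ j → length (cube j) ≡ 2 ^ j
cube-length zero    = refl
cube-length (suc j) = trans (glue-length (cube j) (cube j))
                            (trans (cong₂ _+_ (cube-length j) (cube-length j)) (2^j+2^j j))

nonzero-length : ∀ j → suc (length (nonzero j)) ≡ 2 ^ j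
nonzero-length zero    = refl
nonzero-length (suc j) = begin
  suc (length (glue (cube j) (nonzero j)))     ≡⟨ cong suc (glue-length (cube j) (nonzero j)) ⟩
  suc (length (cube j) + length (nonzero j))   ≡⟨ sym (+-suc (length (cube j)) _) ⟩
  length (cube j) + suc (length (nonzero j))   ≡⟨ cong₂ _+_ (cube-length j) (nonzero-length j) ⟩
  2 ^ j + 2 ^ j                                ≡⟨ 2^j+2^j j ⟩
  2 ^ suc j                                    ∎
  where open ≡-Reasoning

nonunit-length : ∀ j → length (nonunit j) + j ≡ 2 ^ j
nonunit-length zero    = refl
nonunit-length (suc j) = begin
  length (glue (nonzero j) (nonunit j)) + suc j      ≡⟨ cong (_+ suc j) (glue-length (nonzero j) (nonunit j)) ⟩
  (length (nonzero j) + length (nonunit j)) + suc j  ≡⟨ +-assoc (length (nonzero j)) _ _ ⟩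
  length (nonzero j) + (length (nonunit j) + suc j)  ≡⟨ cong (length (nonzero j) +_) (+-suc _ j) ⟩
  length (nonzero j) + suc (length (nonunit j) + j)  ≡⟨ +-suc (length (nonzero j)) _ ⟩
  suc (length (nonzero j)) + (length (nonunit j) + j) ≡⟨ cong₂ _+_ (nonzero-length j) (nonunit-length j) ⟩
  2 ^ j + 2 ^ j                                      ≡⟨ 2^j+2^j j ⟩
  2 ^ suc j                                          ∎
  where open ≡-Reasoning

nonzero-∈ : ∀ j {v} → v ∈ nonzero j → v ≢ zeros
nonzero-∈ (suc j) v∈ with glue-∈ (cube j) (nonzero j) v∈
... | inj₁ (_ , _ , refl)  = λ ()
... | inj₂ (u , u∈ , refl) = λ v≡0 → nonzero-∈ j u∈ (∷-injectiveʳ v≡0)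

nonunit-∈ : ∀ j {v} → v ∈ nonunit j → ∀ i → v ≢ unit i
nonunit-∈ (suc j) v∈ i with glue-∈ (nonzero j) (nonunit j) v∈ | i
... | inj₁ (u , u∈ , refl) | zero  = λ v≡e₀ → nonzero-∈ j u∈ (∷-injectiveʳ v≡e₀)
... | inj₁ (_ , _ , refl)  | suc _ = λ ()
... | inj₂ (_ , _ , refl)  | zero  = λ ()
... | inj₂ (u , u∈ , refl) | suc i = λ v≡eᵢ → nonunit-∈ j u∈ i (∷-injectiveʳ v≡eᵢ)

lookup-injective : ∀ {A : Set} {xs : List A} → Unique xs → ∀ {i j} → List.lookup xs i ≡ List.lookup xs j → i ≡ j
lookup-injective (_ ∷ _) {zero} {zero} _ = refl
lookup-injective (x∉xs ∷ _) {zero} {suc j} eq = ⊥-elim (All.lookup x∉xs (∈-lookup j) eq)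
lookup-injective (x∉xs ∷ _) {suc i} {zero} eq = ⊥-elim (All.lookup x∉xs (∈-lookup i) (sym eq))
lookup-injective (_ ∷ xs-unique) {suc i} {suc j} eq = cong suc (lookup-injective xs-unique eq)

HasSmallSeparators : ℕ → ℕ → Set
HasSmallSeparators n k = (F : List (Subset n)) → Unique F → 2 ^ n < 2 * length F →
  Σ (List (Subset n)) λ G → All (_∈ F) G × length G ≤ k × Separates G

separates-if-differs : ∀ {n} (g : Subset n) x y → lookup g x xor lookup g y ≡ true → SeparatesPair g x y
separates-if-differs g x y differ with lookup g x in gx | lookup g y in gy
... | true  | false = inj₁ (lookup⇒[]= x g gx , λ y∈g → contradiction (trans (sym ([]=⇒lookup y∈g)) gy) λ ())
... | false | true  = inj₂ (lookup⇒[]= y g gy , λ x∈g → contradiction (trans (sym ([]=⇒lookup x∈g)) gx) λ ())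

fiber-density : ∀ L m {f p} → 2 ^ (L + m) < 2 * f → f ≤ 2 ^ m * p → 2 ^ L < 2 * p
fiber-density L m {f} {p} dense large = *-cancelʳ-< (2 ^ m) (2 ^ L) (2 * p) (begin-strict
  2 ^ L * 2 ^ m        ≡⟨ sym (^-distribˡ-+-* 2 L m) ⟩
  2 ^ (L + m)          <⟨ dense ⟩
  2 * f                ≤⟨ *-monoʳ-≤ 2 large ⟩
  2 * (2 ^ m * p)      ≡⟨ cong (2 *_) (*-comm (2 ^ m) p) ⟩
  2 * (p * 2 ^ m)      ≡⟨ sym (*-assoc 2 p (2 ^ m)) ⟩
  2 * p * 2 ^ m        ∎)
  where open ≤-Reasoning

-- Subsets of Fin (L + m) in coordinates adapted to an injective coding of the
-- points by F₂^L: the first L points get the unit vectors, the other m points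
-- the non-unit codes w.
module Decomposition (L m : ℕ) (w : Fin m → Vec Bool L)
                     (w-injective : ∀ {t t′} → w t ≡ w t′ → t ≡ t′)
                     (w-nonunit : ∀ t i → w t ≢ unit i) where

  code : Fin (L + m) → Vec Bool L
  code x = Sum.[ unit , w ]′ (splitAt L x)

  code-injective : ∀ {x y} → code x ≡ code y → x ≡ y
  code-injective {x} {y} eq with splitAt L x in x-split | splitAt L y in y-split
  ... | inj₁ i | inj₁ i′ = trans (sym (splitAt⁻¹-↑ˡ x-split))
                                 (trans (cong (_↑ˡ m) (unit-injective eq)) (splitAt⁻¹-↑ˡ y-split))
  ... | inj₁ i | inj₂ t  = ⊥-elim (w-nonunit t i (sym eq))
  ... | inj₂ t | inj₁ i  = ⊥-elim (w-nonunit t i eq)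
  ... | inj₂ t | inj₂ t′ = trans (sym (splitAt⁻¹-↑ʳ x-split))
                                 (trans (cong (L ↑ʳ_) (w-injective eq)) (splitAt⁻¹-↑ʳ y-split))

  offset : Vec Bool m → Fin (L + m) → Bool
  offset r x = Sum.[ (λ _ → false) , lookup r ]′ (splitAt L x)

  low : Subset (L + m) → Vec Bool L
  low v = tabulate (λ i → lookup v (i ↑ˡ m))

  residual : Subset (L + m) → Vec Bool m
  residual v = tabulate (λ t → dot (w t) (low v) xor lookup v (L ↑ʳ t))

  decompose : ∀ v x → lookup v x ≡ dot (code x) (low v) xor offset (residual v) x
  decompose v x with splitAt L x in x-split
  ... | inj₁ i = begin
    lookup v x                        ≡⟨ cong (lookup v) (sym (splitAt⁻¹-↑ˡ x-split)) ⟩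
    lookup v (i ↑ˡ m)                 ≡⟨ sym (lookup∘tabulate _ i) ⟩
    lookup (low v) i                  ≡⟨ sym (dot-unit i (low v)) ⟩
    dot (unit i) (low v)              ≡⟨ sym (xor-identityʳ _) ⟩
    dot (unit i) (low v) xor false    ∎
    where open ≡-Reasoning
  ... | inj₂ t = begin
    lookup v x                                        ≡⟨ cong (lookup v) (sym (splitAt⁻¹-↑ʳ x-split)) ⟩
    lookup v (L ↑ʳ t)                                 ≡⟨ cong (_xor lookup v (L ↑ʳ t)) (sym (xor-same a)) ⟩
    (a xor a) xor lookup v (L ↑ʳ t)                   ≡⟨ xor-assoc a a _ ⟩
    a xor (a xor lookup v (L ↑ʳ t))                   ≡⟨ cong (a xor_) (sym (lookup∘tabulate _ t)) ⟩
    a xor lookup (residual v) t                       ∎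
    where
    open ≡-Reasoning
    a = dot (w t) (low v)

  low-residual-injective : ∀ {v v′} → residual v ≡ residual v′ → low v ≡ low v′ → v ≡ v′
  low-residual-injective {v} {v′} same-residual same-low =
    trans (sym (tabulate∘lookup v)) (trans (tabulate-cong pointwise) (tabulate∘lookup v′))
    where
    pointwise : ∀ x → lookup v x ≡ lookup v′ x
    pointwise x = trans (decompose v x)
      (trans (cong₂ (λ u r → dot (code x) u xor offset r x) same-low same-residual) (sym (decompose v′ x)))

  difference : ∀ {g r} → residual g ≡ r → ∀ x y →
    lookup g x xor lookup g y ≡ (offset r x xor offset r y) xor dot (code x ⊕ code y) (low g)
  difference {g} refl x y = begin
    lookup g x xor lookup g y
      ≡⟨ cong₂ _xor_ (decompose g x) (decompose g y) ⟩
    (dot (code x) (low g) xor offset r x) xor (dot (code y) (low g) xor offset r y)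
      ≡⟨ xor-interchange (dot (code x) (low g)) _ _ _ ⟩
    (dot (code x) (low g) xor dot (code y) (low g)) xor (offset r x xor offset r y)
      ≡⟨ xor-comm (dot (code x) (low g) xor dot (code y) (low g)) _ ⟩
    (offset r x xor offset r y) xor (dot (code x) (low g) xor dot (code y) (low g))
      ≡⟨ cong ((offset r x xor offset r y) xor_) (sym (dot-⊕ˡ (code x) (code y) (low g))) ⟩
    (offset r x xor offset r y) xor dot (code x ⊕ code y) (low g) ∎
    where
    open ≡-Reasoning
    r = residual g

  separating : HasSmallSeparators (L + m) (L + 1)
  separating F F-unique dense
    with large-fiber m residual F F-unique
  ... | fiber
    with general-position L (map low (members fiber)) (low-unique fiber)
           (subst (λ p → 2 ^ L < 2 * p) (sym (length-map low (members fiber)))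
                  (fiber-density L m dense (large fiber)))
    where
    open LargeFiber
    low-unique : (φ : LargeFiber residual F) → Unique (map low (members φ))
    low-unique φ = unique-map-on low (unique φ) λ v∈ v′∈ →
      low-residual-injective (trans (on-fiber φ v∈) (sym (on-fiber φ v′∈)))
  ... | G₀ , G₀⊆C , |G₀|≤L+1 , spans
    with lift-along low G₀⊆C
  ... | G , G⊆P , refl = G , All.map (LargeFiber.⊆F fiber) G⊆P , length-bound , separates
    where
    open LargeFiber fiber
    length-bound : length G ≤ L + 1
    length-bound = subst₂ _≤_ (length-map low G) (+-comm 1 L) |G₀|≤L+1
    separates : Separates G
    separates x y x≢y with find (Any.map⁻ (spans κ (code x ⊕ code y) (x≢y ∘ code-injective ∘ ⊕-zero⇒≡ ∘ proj₂)))
      where κ = offset value x xor offset value y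
    ... | g , g∈G , hit =
      lose g∈G (separates-if-differs g x y (trans (difference {g} (on-fiber (All.lookup G⊆P g∈G)) x y) hit))

-- For L ≤ n ≤ 2^L the non-unit codes suffice for the last n - L points.
separation-bound : ∀ L n → L ≤ n → n ≤ 2 ^ L → HasSmallSeparators n (L + 1)
separation-bound L n L≤n n≤2^L =
  subst (λ k → HasSmallSeparators k (L + 1)) (m+[n∸m]≡n L≤n)
        (Decomposition.separating L (n ∸ L) w w-injective w-nonunit)
  where
  enough-codes : n ∸ L ≤ length (nonunit L)
  enough-codes = +-cancelʳ-≤ L (n ∸ L) (length (nonunit L)) (begin
    n ∸ L + L                ≡⟨ m∸n+n≡m L≤n ⟩
    n                        ≤⟨ n≤2^L ⟩
    2 ^ L                    ≡⟨ sym (nonunit-length L) ⟩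
    length (nonunit L) + L   ∎)
    where open ≤-Reasoning
  w : Fin (n ∸ L) → Vec Bool L
  w t = List.lookup (nonunit L) (inject≤ t enough-codes)
  w-injective : ∀ {t t′} → w t ≡ w t′ → t ≡ t′
  w-injective eq = inject≤-injective enough-codes enough-codes _ _ (lookup-injective (nonunit-unique L) eq)
  w-nonunit : ∀ t i → w t ≢ unit i
  w-nonunit t = nonunit-∈ L (∈-lookup (inject≤ t enough-codes))

n<2^n : ∀ n → n < 2 ^ n
n<2^n zero    = s≤s z≤n
n<2^n (suc n) = begin-strict
  suc n              <⟨ s≤s (n<2^n n) ⟩
  suc (2 ^ n)        ≡⟨ +-comm 1 (2 ^ n) ⟩
  2 ^ n + 1          ≤⟨ +-monoʳ-≤ (2 ^ n) (m^n>0 2 n) ⟩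
  2 ^ n + 2 ^ n      ≡⟨ 2^j+2^j n ⟩
  2 ^ suc n          ∎
  where open ≤-Reasoning

⌈log₂⌉≤ : ∀ n → ⌈log₂ n ⌉ ≤ n
⌈log₂⌉≤ n = subst (⌈log₂ n ⌉ ≤_) (⌈log₂2^n⌉≡n n) (⌈log₂⌉-mono-≤ (<⇒≤ (n<2^n n)))

≤2^⌈log₂⌉ : ∀ n → n ≤ 2 ^ ⌈log₂ n ⌉
≤2^⌈log₂⌉ = <-rec (λ n → n ≤ 2 ^ ⌈log₂ n ⌉) step
  where
  twice-pred : ∀ k → 1 ≤ k → 2 * 2 ^ (k ∸ 1) ≡ 2 ^ k
  twice-pred (suc k) _ = refl
  step : ∀ n → (∀ {k} → k < n → k ≤ 2 ^ ⌈log₂ k ⌉) → n ≤ 2 ^ ⌈log₂ n ⌉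
  step zero          _   = z≤n
  step (suc zero)    _   = s≤s z≤n
  step n@(suc (suc k)) rec = begin
    n                              ≡⟨ sym (⌊n/2⌋+⌈n/2⌉≡n n) ⟩
    ⌊ n /2⌋ + ⌈ n /2⌉              ≡⟨ +-comm ⌊ n /2⌋ ⌈ n /2⌉ ⟩
    ⌈ n /2⌉ + ⌊ n /2⌋              ≤⟨ sum≤twice-larger refl (⌊n/2⌋≤⌈n/2⌉ n) ⟩
    2 * ⌈ n /2⌉                    ≤⟨ *-monoʳ-≤ 2 (rec (⌈n/2⌉<n k)) ⟩
    2 * 2 ^ ⌈log₂ ⌈ n /2⌉ ⌉        ≡⟨ cong (λ e → 2 * 2 ^ e) (⌈log₂⌈n/2⌉⌉≡⌈log₂n⌉∸1 n) ⟩
    2 * 2 ^ (⌈log₂ n ⌉ ∸ 1)        ≡⟨ twice-pred ⌈log₂ n ⌉ (⌈log₂⌉-mono-≤ {2} {n} (s≤s (s≤s z≤n))) ⟩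
    2 ^ ⌈log₂ n ⌉                  ∎
    where open ≤-Reasoning

theorem1 : (n : ℕ) → 1 ≤ n → (ℱ : List (Subset n)) → Unique ℱ →
    2 ^ (n ∸ 1) < length ℱ →
    Σ (List (Subset n)) (λ 𝒢 → All (λ G → G ∈ ℱ) 𝒢 × length 𝒢 ≤ ⌈log₂ n ⌉ + 1 × Separates 𝒢)
theorem1 n@(suc k) _ ℱ ℱ-unique more-than-half =
  separation-bound ⌈log₂ n ⌉ n (⌈log₂⌉≤ n) (≤2^⌈log₂⌉ n) ℱ ℱ-unique (*-monoʳ-< 2 more-than-half)
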